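{- Let $u$ be any sequence of the form $a v a v' a$ such that $a$ is a letter, $v$ is a nonempty sequence not containing the letter $a$ with no repeated letters, and $v'$ is obtained from $v$ by only moving the first letter of $v$ to another place in $v$. Then $\mathit{fw}(u)=4$.
   Context: A sequence $s$ contains a sequence $u$ if some subsequence of $s$ can be changed into $u$ by a one-to-one renaming of its letters. An $(r,s)$-formation is a concatenation of $s$ permutations of the same set of $r$ distinct letters. The formation width $\mathit{fw}(u)$ is the minimum $s$ such that there exists $r$ for which every $(r,s)$-formation contains $u$. -}

module Defs where

open import Data.Nat using (ℕ; _<_)
open import Data.List using (List; []; _∷_; map; concat; length)
open import Data.List.Membership.Propositional using (_∈_)
open import Data.List.Relation.Binary.Sublist.Propositional using (_⊆_)
open import Data.List.Relation.Binary.Permutation.Propositional using (_↭_)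
open import Data.List.Relation.Unary.All using (All)
open import Data.List.Relation.Unary.Unique.Propositional using (Unique)
open import Data.Product using (Σ; _×_; ∃)
open import Relation.Binary.PropositionalEquality using (_≡_)
open import Relation.Nullary using (¬_)

Seq : Set
Seq = List ℕ

InjectiveOn : (ℕ → ℕ) → Seq → Set
InjectiveOn φ w = ∀ {x y} → x ∈ w → y ∈ w → φ x ≡ φ y → x ≡ y

Contains : Seq → Seq → Set
Contains s u = Σ Seq λ w → (w ⊆ s) × Σ (ℕ → ℕ) λ φ → InjectiveOn φ w × (map φ w ≡ u)

Formation : ℕ → ℕ → Seq → Set
Formation r s f =
  Σ Seq λ L → (length L ≡ r) × Unique L ×
    Σ (List Seq) λ ps → (length ps ≡ s) × All (_↭ L) ps × (f ≡ concat ps)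

FwBound : Seq → ℕ → Set
FwBound u s = ∃ λ r → ∀ f → Formation r s f → Contains f u

FwIs : Seq → ℕ → Set
FwIs u s = FwBound u s × (∀ t → t < s → ¬ FwBound u t)

-- Upper bound: applying Erdős–Szekeres three times inside the first block of a 4-block formation
-- on sufficiently many letters (a tower of exponentials in |u|) leaves |u| letters S that each
-- later block lists either in the order of S or in reverse.  Hence the formation contains an
-- "oriented" formation on S, of one of eight shapes, and for each shape the letters of u can be
-- ordered as some T so that u is a subsequence of the oriented formation on T, a renaming of the
-- one on S.
-- Lower bound: in t copies of 0 1 … r−1 every subsequence has at most t − 1 descents.  Since the
-- letter c following b in v precedes b in v′, u contains a b c a c b a, and every x y z x z y x
-- with distinct letters has exactly three descents; so t ≥ 4.
module Submission where

open import Defs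
open import Data.Nat using (ℕ; zero; suc; _+_; _*_; _^_; _≤_; _<_; z≤n; s≤s; _≟_; _≤?_; _<?_)
open import Data.Nat.Properties
  using ( +-suc; +-identityʳ; +-assoc; +-mono-≤; +-monoˡ-≤; +-monoʳ-≤; ≤-refl; ≤-reflexive; ≤-trans
        ; ≤-antisym; ≰⇒>; ≮⇒≥; <-irrefl; <-asym; <⇒≱; n≤1+n; n<1+n; suc-injective; m^n>0; m≤n⇒m⊓n≡m
        ; module ≤-Reasoning)
open import Data.Nat.Solver using (module +-*-Solver)
open import Data.List
  using (List; []; _∷_; _++_; [_]; map; length; reverse; take; drop; concat; replicate; upTo)
open import Data.List.Properties
  using ( map-cong-local; unfold-reverse; reverse-map; reverse-involutive; concat-map; length-take
        ; length-upTo; length-replicate; ++-identityʳ; take++drop≡id; ++-monoid)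
open import Data.List.Membership.Propositional using (_∈_; _∉_)
open import Data.List.Membership.Propositional.Properties using (∈-map⁺; ∈-∃++; ∈-++⁻)
open import Data.List.Membership.DecPropositional _≟_ using (_∈?_)
open import Data.List.Relation.Binary.Sublist.Propositional
  using (_⊆_; []; _∷_; _∷ʳ_; ⊆-refl; ⊆-trans; ⊆-reflexive; minimum; lookup; from∈)
open import Data.List.Relation.Binary.Sublist.Propositional.Properties
  using (++⁺; ++⁺ˡ; ++⁺ʳ; reverse⁺; take-⊆; All-resp-⊆)
open import Data.List.Relation.Binary.Permutation.Propositional
  using (_↭_; ↭-refl; ↭-sym; ↭-trans; ↭⇒↭ₛ)
open import Data.List.Relation.Binary.Permutation.Propositional.Properties
  using (∈-resp-↭; ↭-length; ++-comm; ↭-reverse; ++-commutativeMonoid)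
import Data.List.Relation.Binary.Permutation.Setoid.Properties as Permutationₛ
open import Data.List.Relation.Binary.Pointwise as Pointwise using (_∷_; []; ≡⇒Pointwise-≡)
open import Data.List.Relation.Unary.All as All using (All; []; _∷_)
open import Data.List.Relation.Unary.All.Properties using (¬Any⇒All¬; concat⁺; replicate⁺)
open import Data.List.Relation.Unary.AllPairs using (AllPairs; []; _∷_)
open import Data.List.Relation.Unary.AllPairs.Properties using (applyUpTo⁺₁)
open import Data.List.Relation.Unary.Any using (here; there)
import Data.List.Relation.Unary.Any.Properties as Any
open import Data.List.Relation.Unary.Unique.Propositional using (Unique)
open import Data.List.Relation.Unary.Unique.Propositional.Properties using (upTo⁺)
open import Data.Product using (∃-syntax; ∃₂; _×_; _,_)
open import Data.Sum using (_⊎_; inj₁; inj₂)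
open import Function using (id; _∘_)
open import Level using (Level)
open import Relation.Nullary using (¬_; yes; no; contradiction)
open import Relation.Binary.Core using (Rel)
open import Relation.Binary.Definitions using (_Respects_)
open import Relation.Binary.PropositionalEquality
  using (_≡_; _≢_; refl; sym; trans; cong; cong₂; subst; setoid; module ≡-Reasoning)
import Algebra.Solver.Monoid as MonoidSolver
import Algebra.Solver.CommutativeMonoid as CommutativeMonoidSolver

private
  variable
    ℓ : Level
    A B : Set

AllPairs-resp-⊆ : ∀ {R : Rel A ℓ} {xs ys} → xs ⊆ ys → AllPairs R ys → AllPairs R xs
AllPairs-resp-⊆ []             []         = []
AllPairs-resp-⊆ (y ∷ʳ xs⊆ys)   (_ ∷ Rys)  = AllPairs-resp-⊆ xs⊆ys Rys
AllPairs-resp-⊆ (refl ∷ xs⊆ys) (Ry ∷ Rys) = All-resp-⊆ xs⊆ys Ry ∷ AllPairs-resp-⊆ xs⊆ys Rys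

Unique-resp-↭ : Unique {A = A} Respects _↭_
Unique-resp-↭ xs↭ys = Permutationₛ.Unique-resp-↭ (setoid _) (↭⇒↭ₛ xs↭ys)

members-↭ : ∀ {xs ys zs : List A} → xs ↭ zs → ys ↭ zs → All (_∈ ys) xs
members-↭ xs↭zs ys↭zs = All.tabulate (∈-resp-↭ (↭-trans xs↭zs (↭-sym ys↭zs)))

⊆-map⁻ : ∀ (f : A → B) {u} xs → u ⊆ map f xs → ∃[ ws ] ws ⊆ xs × map f ws ≡ u
⊆-map⁻ f []       []          = [] , [] , refl
⊆-map⁻ f (x ∷ xs) (_ ∷ʳ u⊆)   with ws , ws⊆ , eq ← ⊆-map⁻ f xs u⊆ = ws , x ∷ʳ ws⊆ , eq
⊆-map⁻ f (x ∷ xs) (refl ∷ u⊆) with ws , ws⊆ , eq ← ⊆-map⁻ f xs u⊆ = x ∷ ws , refl ∷ ws⊆ , cong (f x ∷_) eq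

⊆-++⁻ : ∀ {xs} (ys zs : List A) → xs ⊆ ys ++ zs →
  ∃₂ λ xs₁ xs₂ → xs ≡ xs₁ ++ xs₂ × xs₁ ⊆ ys × xs₂ ⊆ zs
⊆-++⁻ {xs = xs} [] zs xs⊆ = [] , xs , refl , [] , xs⊆
⊆-++⁻ (y ∷ ys) zs (_ ∷ʳ xs⊆) with xs₁ , xs₂ , refl , ⊆ys , ⊆zs ← ⊆-++⁻ ys zs xs⊆ =
  xs₁ , xs₂ , refl , y ∷ʳ ⊆ys , ⊆zs
⊆-++⁻ (y ∷ ys) zs (refl ∷ xs⊆) with xs₁ , xs₂ , refl , ⊆ys , ⊆zs ← ⊆-++⁻ ys zs xs⊆ =
  y ∷ xs₁ , xs₂ , refl , refl ∷ ⊆ys , ⊆zs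

injectiveOn-restrict : ∀ {φ xs ys} → All (_∈ xs) ys → InjectiveOn φ xs → InjectiveOn φ ys
injectiveOn-restrict ys⊆xs inj x∈ y∈ = inj (All.lookup ys⊆xs x∈) (All.lookup ys⊆xs y∈)

Unique-map⇒injectiveOn : ∀ {φ} xs → Unique (map φ xs) → InjectiveOn φ xs
Unique-map⇒injectiveOn (x ∷ xs) (φx∉ ∷ u) (here refl) (here refl) _  = refl
Unique-map⇒injectiveOn (x ∷ xs) (φx∉ ∷ u) (here refl) (there y∈) eq =
  contradiction eq (All.lookup φx∉ (∈-map⁺ _ y∈))
Unique-map⇒injectiveOn (x ∷ xs) (φx∉ ∷ u) (there x∈) (here refl) eq =
  contradiction (sym eq) (All.lookup φx∉ (∈-map⁺ _ x∈))
Unique-map⇒injectiveOn (x ∷ xs) (φx∉ ∷ u) (there x∈) (there y∈) eq =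
  Unique-map⇒injectiveOn xs u x∈ y∈ eq

redirect : ℕ → ℕ → (ℕ → ℕ) → ℕ → ℕ
redirect x y φ z with z ≟ x
... | yes _ = y
... | no  _ = φ z

renaming-onto : ∀ xs ys → Unique xs → length xs ≡ length ys → ∃[ φ ] map φ xs ≡ ys
renaming-onto []       []       _          _   = id , refl
renaming-onto (x ∷ xs) (y ∷ ys) (x∉ ∷ uxs) len
  with φ , eq ← renaming-onto xs ys uxs (suc-injective len) =
  redirect x y φ , cong₂ _∷_ redirect-x (trans (map-cong-local (All.map redirect-≢ x∉)) eq)
  where
  redirect-x : redirect x y φ x ≡ y
  redirect-x with x ≟ x
  ... | yes _  = refl
  ... | no x≢x = contradiction refl x≢x
  redirect-≢ : ∀ {z} → x ≢ z → redirect x y φ z ≡ φ z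
  redirect-≢ {z} x≢z with z ≟ x
  ... | yes z≡x = contradiction (sym z≡x) x≢z
  ... | no  _   = refl

contains-renamed : ∀ {f h u φ} → h ⊆ f → InjectiveOn φ h → u ⊆ map φ h → Contains f u
contains-renamed {h = h} {φ = φ} h⊆f inj u⊆ with ws , ws⊆h , eq ← ⊆-map⁻ φ h u⊆ =
  ws , ⊆-trans ws⊆h h⊆f , φ , injectiveOn-restrict (All.tabulate (lookup ws⊆h)) inj , eq

contains-⊆ : ∀ {f u v} → Contains f u → v ⊆ u → Contains f v
contains-⊆ (ws , ws⊆f , φ , inj , refl) v⊆ = contains-renamed ws⊆f inj v⊆

pigeonhole : ∀ n {k l} → 2 * n ≤ suc (k + l) → n ≤ k ⊎ n ≤ l
pigeonhole n {k} {l} 2n≤ with n ≤? k | n ≤? l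
... | yes n≤k | _       = inj₁ n≤k
... | no  _   | yes n≤l = inj₂ n≤l
... | no  n≰k | no  n≰l =
  contradiction (subst (λ x → suc x ≤ suc (k + l)) (+-suc k l) too-big) (<-irrefl refl)
  where
  too-big : suc k + suc l ≤ suc (k + l)
  too-big = ≤-trans (+-mono-≤ (≰⇒> n≰k) (≰⇒> n≰l))
    (subst (_≤ suc (k + l)) (cong (n +_) (+-identityʳ n)) 2n≤)

partitionAround : ∀ (q₁ q₂ : List ℕ) {s} (S : List ℕ) → All (s ≢_) S → All (_∈ q₁ ++ s ∷ q₂) S →
  ∃₂ λ E L → E ⊆ S × L ⊆ S × length E + length L ≡ length S × All (_∈ q₁) E × All (_∈ q₂) L
partitionAround q₁ q₂ [] _ _ = [] , [] , [] , [] , refl , [] , []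
partitionAround q₁ q₂ (y ∷ S) (s≢y ∷ s∉S) (y∈q ∷ S∈q)
  with E , L , E⊆S , L⊆S , len , E∈q₁ , L∈q₂ ← partitionAround q₁ q₂ S s∉S S∈q | y ∈? q₂
... | yes y∈q₂ =
  E , y ∷ L , y ∷ʳ E⊆S , refl ∷ L⊆S , trans (+-suc _ _) (cong suc len) , E∈q₁ , y∈q₂ ∷ L∈q₂
... | no  y∉q₂ = y ∷ E , L , refl ∷ E⊆S , y ∷ʳ L⊆S , cong suc len , y∈q₁ ∷ E∈q₁ , L∈q₂
  where
  y∈q₁ : y ∈ q₁
  y∈q₁ with ∈-++⁻ q₁ y∈q
  ... | inj₁ y∈q₁         = y∈q₁
  ... | inj₂ (here y≡s)   = contradiction (sym y≡s) s≢y
  ... | inj₂ (there y∈q₂) = contradiction y∈q₂ y∉q₂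

erdős-szekeres : ∀ m n {q : List ℕ} (S : List ℕ) → Unique S → All (_∈ q) S → 2 ^ (m + n) ≤ length S →
  ∃[ T ] T ⊆ S × (m ≤ length T × T ⊆ q ⊎ n ≤ length T × reverse T ⊆ q)
erdős-szekeres zero    n       S _ _ _ = [] , minimum S , inj₁ (z≤n , minimum _)
erdős-szekeres (suc m) zero    S _ _ _ = [] , minimum S , inj₂ (z≤n , minimum _)
erdős-szekeres (suc m) (suc n) [] _ _ len = contradiction len (<⇒≱ (m^n>0 2 (suc m + suc n)))
erdős-szekeres (suc m) (suc n) (s ∷ S) (s∉S ∷ uS) (s∈q ∷ S∈q) len
  with q₁ , q₂ , refl ← ∈-∃++ s∈q
  with E , L , E⊆S , L⊆S , |E|+|L| , E∈q₁ , L∈q₂ ← partitionAround q₁ q₂ S s∉S S∈q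
  with pigeonhole (2 ^ (m + suc n)) (subst (λ k → 2 ^ (suc m + suc n) ≤ suc k) (sym |E|+|L|) len)
... | inj₁ bigE
  with erdős-szekeres (suc m) n E (AllPairs-resp-⊆ E⊆S uS) E∈q₁
         (subst (λ k → 2 ^ k ≤ length E) (+-suc m n) bigE)
...   | T , T⊆E , inj₁ (l , T⊆q₁) = T , s ∷ʳ ⊆-trans T⊆E E⊆S , inj₁ (l , ++⁺ʳ (s ∷ q₂) T⊆q₁)
...   | T , T⊆E , inj₂ (l , T↙q₁) = s ∷ T , refl ∷ ⊆-trans T⊆E E⊆S ,
  inj₂ (s≤s l , subst (_⊆ q₁ ++ s ∷ q₂) (sym (unfold-reverse s T)) (++⁺ T↙q₁ (refl ∷ minimum q₂)))
erdős-szekeres (suc m) (suc n) (s ∷ S) (s∉S ∷ uS) (s∈q ∷ S∈q) len | inj₂ bigL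
  with erdős-szekeres m (suc n) L (AllPairs-resp-⊆ L⊆S uS) L∈q₂ bigL
...   | T , T⊆L , inj₁ (l , T⊆q₂) =
  s ∷ T , refl ∷ ⊆-trans T⊆L L⊆S , inj₁ (s≤s l , ++⁺ˡ q₁ (refl ∷ T⊆q₂))
...   | T , T⊆L , inj₂ (l , T↙q₂) = T , s ∷ʳ ⊆-trans T⊆L L⊆S , inj₂ (l , ++⁺ˡ q₁ (s ∷ʳ T↙q₂))

data Direction : Set where
  forward backward : Direction

orient : Direction → List A → List A
orient forward  = id
orient backward = reverse

orient⁺ : ∀ d {xs ys : List A} → xs ⊆ ys → orient d xs ⊆ orient d ys
orient⁺ forward  = id
orient⁺ backward = reverse⁺

∈-orient⁻ : ∀ d {x} {xs : List A} → x ∈ orient d xs → x ∈ xs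
∈-orient⁻ forward  = id
∈-orient⁻ backward = Any.reverse⁻

∈-orient⁺ : ∀ d {x} {xs : List A} → x ∈ xs → x ∈ orient d xs
∈-orient⁺ forward  = id
∈-orient⁺ backward = Any.reverse⁺

map-orient : ∀ (f : A → B) d xs → map f (orient d xs) ≡ orient d (map f xs)
map-orient f forward  xs = refl
map-orient f backward xs = reverse-map f xs

monotone-sublist : ∀ m {q} S → Unique S → All (_∈ q) S → 2 ^ (m + m) ≤ length S →
  ∃[ T ] T ⊆ S × m ≤ length T × ∃[ d ] orient d T ⊆ q
monotone-sublist m S uS S∈q len with erdős-szekeres m m S uS S∈q len
... | T , T⊆S , inj₁ (l , T⊆q) = T , T⊆S , l , forward  , T⊆q
... | T , T⊆S , inj₂ (l , T↙q) = T , T⊆S , l , backward , T↙q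

tower : ℕ → ℕ → ℕ
tower zero    m = m
tower (suc k) m = 2 ^ (tower k m + tower k m)

monotone-in-all : ∀ m S qs → Unique S → All (λ q → All (_∈ q) S) qs → tower (length qs) m ≤ length S →
  ∃[ T ] T ⊆ S × m ≤ length T × All (λ q → ∃[ d ] orient d T ⊆ q) qs
monotone-in-all m S []       _  _            len = S , ⊆-refl , len , []
monotone-in-all m S (q ∷ qs) uS (S∈q ∷ S∈qs) len
  with T₁ , T₁⊆S , len₁ , d , T₁↗q ← monotone-sublist (tower (length qs) m) S uS S∈q len
  with T , T⊆T₁ , lenT , T↗qs ←
         monotone-in-all m T₁ qs (AllPairs-resp-⊆ T₁⊆S uS) (All.map (All-resp-⊆ T₁⊆S) S∈qs) len₁
  = T , ⊆-trans T⊆T₁ T₁⊆S , lenT , (d , ⊆-trans (orient⁺ d T⊆T₁) T₁↗q) ∷ T↗qs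

orientedFormation : List ℕ → Direction → Direction → Direction → List ℕ
orientedFormation S d₂ d₃ d₄ = concat (S ∷ orient d₂ S ∷ orient d₃ S ∷ orient d₄ S ∷ [])

orientedFormation⁺ : ∀ {T P₁ P₂ P₃ P₄} d₂ d₃ d₄ →
  P₁ ⊆ T → P₂ ⊆ orient d₂ T → P₃ ⊆ orient d₃ T → P₄ ⊆ orient d₄ T →
  concat (P₁ ∷ P₂ ∷ P₃ ∷ P₄ ∷ []) ⊆ orientedFormation T d₂ d₃ d₄
orientedFormation⁺ _ _ _ P₁⊆ P₂⊆ P₃⊆ P₄⊆ = ++⁺ P₁⊆ (++⁺ P₂⊆ (++⁺ P₃⊆ (++⁺ P₄⊆ [])))

∈-orientedFormation⁻ : ∀ S d₂ d₃ d₄ → All (_∈ S) (orientedFormation S d₂ d₃ d₄)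
∈-orientedFormation⁻ S d₂ d₃ d₄ =
  concat⁺ (in-orient forward ∷ in-orient d₂ ∷ in-orient d₃ ∷ in-orient d₄ ∷ [])
  where
  in-orient : ∀ d → All (_∈ S) (orient d S)
  in-orient d = All.tabulate (∈-orient⁻ d)

map-orientedFormation : ∀ φ S d₂ d₃ d₄ →
  map φ (orientedFormation S d₂ d₃ d₄) ≡ orientedFormation (map φ S) d₂ d₃ d₄
map-orientedFormation φ S d₂ d₃ d₄ = begin
  map φ (concat (S ∷ orient d₂ S ∷ orient d₃ S ∷ orient d₄ S ∷ []))
    ≡⟨ concat-map (S ∷ orient d₂ S ∷ orient d₃ S ∷ orient d₄ S ∷ []) ⟨
  concat (map φ S ∷ map φ (orient d₂ S) ∷ map φ (orient d₃ S) ∷ map φ (orient d₄ S) ∷ [])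
    ≡⟨ cong₂ (λ X Y → concat (map φ S ∷ X ∷ Y)) (map-orient φ d₂ S)
         (cong₂ (λ X Y → X ∷ Y ∷ []) (map-orient φ d₃ S) (map-orient φ d₄ S)) ⟩
  orientedFormation (map φ S) d₂ d₃ d₄ ∎
  where open ≡-Reasoning

orientedSubformation : ∀ m f → Formation (tower 3 m) 4 f →
  ∃[ S ] Unique S × length S ≡ m × ∃[ d₂ ] ∃[ d₃ ] ∃[ d₄ ] orientedFormation S d₂ d₃ d₄ ⊆ f
orientedSubformation m _ (L , |L| , uL , p₁ ∷ p₂ ∷ p₃ ∷ p₄ ∷ [] , refl , π₁ ∷ π₂ ∷ π₃ ∷ π₄ ∷ [] , refl)
  with u₁ ← Unique-resp-↭ (↭-sym π₁) uL
  with T , T⊆p₁ , m≤|T| , (d₂ , T↗p₂) ∷ (d₃ , T↗p₃) ∷ (d₄ , T↗p₄) ∷ [] ←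
         monotone-in-all m p₁ (p₂ ∷ p₃ ∷ p₄ ∷ []) u₁
           (members-↭ π₁ π₂ ∷ members-↭ π₁ π₃ ∷ members-↭ π₁ π₄ ∷ [])
           (≤-reflexive (sym (trans (↭-length π₁) |L|)))
  = S , AllPairs-resp-⊆ (⊆-trans S⊆T T⊆p₁) u₁ , trans (length-take m T) (m≤n⇒m⊓n≡m m≤|T|) ,
    d₂ , d₃ , d₄ ,
    ++⁺ (⊆-trans S⊆T T⊆p₁) (++⁺ (shrink d₂ T↗p₂) (++⁺ (shrink d₃ T↗p₃) (++⁺ (shrink d₄ T↗p₄) [])))
  where
  S = take m T
  S⊆T = take-⊆ m T
  shrink : ∀ d {q} → orient d T ⊆ q → orient d S ⊆ q
  shrink d T↗q = ⊆-trans (orient⁺ d S⊆T) T↗q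

orientedFormation-contains : ∀ {f u} S T d₂ d₃ d₄ → Unique S → Unique T → length S ≡ length T →
  orientedFormation S d₂ d₃ d₄ ⊆ f → u ⊆ orientedFormation T d₂ d₃ d₄ → Contains f u
orientedFormation-contains {u = u} S T d₂ d₃ d₄ uS uT |S|≡|T| S-formation⊆f u⊆T-formation
  with φ , φS≡T ← renaming-onto S T uS |S|≡|T|
  = contains-renamed S-formation⊆f
      (injectiveOn-restrict (∈-orientedFormation⁻ S d₂ d₃ d₄)
        (Unique-map⇒injectiveOn S (subst Unique (sym φS≡T) uT)))
      (subst (u ⊆_) (sym renamed) u⊆T-formation)
  where
  renamed : map φ (orientedFormation S d₂ d₃ d₄) ≡ orientedFormation T d₂ d₃ d₄
  renamed = trans (map-orientedFormation φ S d₂ d₃ d₄) (cong (λ X → orientedFormation X d₂ d₃ d₄) φS≡T)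

-- The paper's u = a v a v′ a with v = b w₁ w₂ and v′ = w₁ b w₂.
avav′a : ℕ → ℕ → List ℕ → List ℕ → List ℕ
avav′a a b w₁ w₂ = a ∷ (b ∷ w₁ ++ w₂) ++ a ∷ (w₁ ++ b ∷ w₂) ++ [ a ]

module _ (a b : ℕ) (w₁ w₂ : List ℕ) where

  private
    open MonoidSolver (++-monoid ℕ) using (solve; _⊜_; _⊕_) renaming (id to ε)
    module CM = CommutativeMonoidSolver (++-commutativeMonoid {A = ℕ})

    K R : List ℕ
    K = a ∷ b ∷ w₁ ++ w₂
    R = w₁ ++ b ∷ w₂ ++ [ a ]

    R↭K : R ↭ K
    R↭K = CM.solve 4 (λ A B W₁ W₂ → W₁ CM.⊕ B CM.⊕ W₂ CM.⊕ A CM.⊜ A CM.⊕ B CM.⊕ W₁ CM.⊕ W₂)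
      ↭-refl [ a ] [ b ] w₁ w₂

    split₁ : avav′a a b w₁ w₂ ≡ concat (K ∷ (a ∷ w₁) ∷ (b ∷ w₂) ∷ [ a ] ∷ [])
    split₁ = solve 4 (λ A B W₁ W₂ → A ⊕ (B ⊕ W₁ ⊕ W₂) ⊕ A ⊕ (W₁ ⊕ B ⊕ W₂) ⊕ A
      ⊜ (A ⊕ B ⊕ W₁ ⊕ W₂) ⊕ (A ⊕ W₁) ⊕ (B ⊕ W₂) ⊕ A ⊕ ε) refl [ a ] [ b ] w₁ w₂

    split₂ : avav′a a b w₁ w₂ ≡ concat ((a ∷ b ∷ w₁) ∷ (w₂ ++ a ∷ w₁) ∷ [ b ] ∷ (w₂ ++ [ a ]) ∷ [])
    split₂ = solve 4 (λ A B W₁ W₂ → A ⊕ (B ⊕ W₁ ⊕ W₂) ⊕ A ⊕ (W₁ ⊕ B ⊕ W₂) ⊕ A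
      ⊜ (A ⊕ B ⊕ W₁) ⊕ (W₂ ⊕ A ⊕ W₁) ⊕ B ⊕ (W₂ ⊕ A) ⊕ ε) refl [ a ] [ b ] w₁ w₂

    split₃ : avav′a a b w₁ w₂ ≡ concat ([ a ] ∷ [ b ] ∷ (w₁ ++ w₂ ++ [ a ]) ∷ R ∷ [])
    split₃ = solve 4 (λ A B W₁ W₂ → A ⊕ (B ⊕ W₁ ⊕ W₂) ⊕ A ⊕ (W₁ ⊕ B ⊕ W₂) ⊕ A
      ⊜ A ⊕ B ⊕ (W₁ ⊕ W₂ ⊕ A) ⊕ (W₁ ⊕ B ⊕ W₂ ⊕ A) ⊕ ε) refl [ a ] [ b ] w₁ w₂

    ba⊆R : b ∷ a ∷ [] ⊆ R
    ba⊆R = ++⁺ˡ w₁ (refl ∷ ++⁺ˡ w₂ (refl ∷ []))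

    w₁w₂a⊆R : w₁ ++ w₂ ++ [ a ] ⊆ R
    w₁w₂a⊆R = ++⁺ ⊆-refl (b ∷ʳ ⊆-refl)

    ⊆R⇒⊆reverse² : ∀ {P} → P ⊆ R → P ⊆ reverse (reverse R)
    ⊆R⇒⊆reverse² = subst (_ ⊆_) (sym (reverse-involutive R))

  -- In the last three cases (at least two backward blocks) the pieces a b, w₁ w₂ a and w₁ b w₂ a
  -- of u go into the first block and two backward blocks, and the remaining block is skipped.
  layout : ∀ d₂ d₃ d₄ → ∃[ T ] T ↭ K × avav′a a b w₁ w₂ ⊆ orientedFormation T d₂ d₃ d₄
  layout forward forward d₄ = K , ↭-refl , ⊆-trans (⊆-reflexive split₁)
    (orientedFormation⁺ forward forward d₄ ⊆-refl (refl ∷ b ∷ʳ ++⁺ʳ w₂ ⊆-refl)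
      (a ∷ʳ refl ∷ ++⁺ˡ w₁ ⊆-refl) (from∈ (∈-orient⁺ d₄ (here refl))))
  layout forward backward forward = w₂ ++ a ∷ b ∷ w₁ , ++-comm w₂ (a ∷ b ∷ w₁) , ⊆-trans (⊆-reflexive split₂)
    (orientedFormation⁺ forward backward forward (++⁺ˡ w₂ ⊆-refl) (++⁺ ⊆-refl (refl ∷ b ∷ʳ ⊆-refl))
      (reverse⁺ (++⁺ˡ w₂ (a ∷ʳ refl ∷ minimum w₁))) (++⁺ ⊆-refl (refl ∷ minimum _)))
  layout backward forward forward = R , R↭K , ⊆-trans (⊆-reflexive split₃)
    (orientedFormation⁺ backward forward forward (++⁺ˡ w₁ (b ∷ʳ ++⁺ˡ w₂ (refl ∷ [])))
      (reverse⁺ (++⁺ˡ w₁ (refl ∷ minimum _))) w₁w₂a⊆R ⊆-refl)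
  layout forward backward backward = reverse R , ↭-trans (↭-reverse R) R↭K , ⊆-trans (⊆-reflexive split₃)
    (orientedFormation⁺ forward backward backward (reverse⁺ ba⊆R) (minimum _)
      (⊆R⇒⊆reverse² w₁w₂a⊆R) (⊆R⇒⊆reverse² ⊆-refl))
  layout backward forward backward = reverse R , ↭-trans (↭-reverse R) R↭K , ⊆-trans (⊆-reflexive split₃)
    (orientedFormation⁺ backward forward backward (reverse⁺ ba⊆R) (⊆R⇒⊆reverse² w₁w₂a⊆R)
      (minimum _) (⊆R⇒⊆reverse² ⊆-refl))
  layout backward backward d₄ = reverse R , ↭-trans (↭-reverse R) R↭K , ⊆-trans (⊆-reflexive split₃)
    (orientedFormation⁺ backward backward d₄ (reverse⁺ ba⊆R) (⊆R⇒⊆reverse² w₁w₂a⊆R)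
      (⊆R⇒⊆reverse² ⊆-refl) (minimum _))

fw≤4 : ∀ a b w₁ w₂ → Unique (a ∷ b ∷ w₁ ++ w₂) → FwBound (avav′a a b w₁ w₂) 4
fw≤4 a b w₁ w₂ uK = tower 3 (length (a ∷ b ∷ w₁ ++ w₂)) , contains
  where
  contains : ∀ f → Formation (tower 3 (length (a ∷ b ∷ w₁ ++ w₂))) 4 f → Contains f (avav′a a b w₁ w₂)
  contains f F
    with S , uS , |S| , d₂ , d₃ , d₄ , S-formation⊆f ← orientedSubformation _ f F
    with T , T↭K , u⊆T-formation ← layout a b w₁ w₂ d₂ d₃ d₄
    = orientedFormation-contains S T d₂ d₃ d₄ uS (Unique-resp-↭ (↭-sym T↭K) uK)
        (trans |S| (sym (↭-length T↭K))) S-formation⊆f u⊆T-formation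

descent : ℕ → ℕ → ℕ
descent x y with x <? y
... | yes _ = 0
... | no  _ = 1

descents : List ℕ → ℕ
descents []           = 0
descents (x ∷ [])     = 0
descents (x ∷ y ∷ xs) = descent x y + descents (y ∷ xs)

descent≤1 : ∀ x y → descent x y ≤ 1
descent≤1 x y with x <? y
... | yes _ = z≤n
... | no  _ = ≤-refl

descent-< : ∀ {x y} → x < y → descent x y ≡ 0
descent-< {x} {y} x<y with x <? y
... | yes _   = refl
... | no  x≮y = contradiction x<y x≮y

descent-swap : ∀ {x y} → x ≢ y → descent x y + descent y x ≡ 1
descent-swap {x} {y} x≢y with x <? y | y <? x
... | yes x<y | yes y<x = contradiction y<x (<-asym x<y)
... | yes _   | no  _   = refl
... | no  _   | yes _   = refl
... | no  x≮y | no  y≮x = contradiction (≤-antisym (≮⇒≥ y≮x) (≮⇒≥ x≮y)) x≢y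

descents-++ : ∀ xs ys → descents (xs ++ ys) ≤ descents xs + suc (descents ys)
descents-++ []           ys       = n≤1+n _
descents-++ (x ∷ [])     []       = z≤n
descents-++ (x ∷ [])     (y ∷ ys) = +-monoˡ-≤ (descents (y ∷ ys)) (descent≤1 x y)
descents-++ (x ∷ y ∷ xs) ys       = ≤-trans (+-monoʳ-≤ (descent x y) (descents-++ (y ∷ xs) ys))
  (≤-reflexive (sym (+-assoc (descent x y) (descents (y ∷ xs)) _)))

descents-ascending : ∀ {xs} → AllPairs _<_ xs → descents xs ≡ 0
descents-ascending []                        = refl
descents-ascending (_ ∷ [])                  = refl
descents-ascending ((x<y ∷ _) ∷ asc@(_ ∷ _)) = cong₂ _+_ (descent-< x<y) (descents-ascending asc)

descents-⊆-replicate : ∀ {ys} → AllPairs _<_ ys → ∀ t xs → xs ⊆ concat (replicate (suc t) ys) →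
  descents xs ≤ t
descents-⊆-replicate {ys} asc zero xs xs⊆ =
  ≤-reflexive (descents-ascending (AllPairs-resp-⊆ (subst (xs ⊆_) (++-identityʳ ys) xs⊆) asc))
descents-⊆-replicate {ys} asc (suc t) xs xs⊆ with xs₁ , xs₂ , refl , xs₁⊆ , xs₂⊆ ← ⊆-++⁻ ys _ xs⊆ =
  begin
    descents (xs₁ ++ xs₂)             ≤⟨ descents-++ xs₁ xs₂ ⟩
    descents xs₁ + suc (descents xs₂) ≡⟨ cong (_+ _) (descents-ascending (AllPairs-resp-⊆ xs₁⊆ asc)) ⟩
    suc (descents xs₂)                ≤⟨ s≤s (descents-⊆-replicate asc t xs₂ xs₂⊆) ⟩
    suc t                             ∎
  where open ≤-Reasoning

abcacba : ℕ → ℕ → ℕ → List ℕ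
abcacba a b c = a ∷ b ∷ c ∷ a ∷ c ∷ b ∷ a ∷ []

descents-abcacba : ∀ {x y z} → x ≢ y → y ≢ z → x ≢ z → descents (abcacba x y z) ≡ 3
descents-abcacba {x} {y} {z} x≢y y≢z x≢z = begin
  descents (abcacba x y z)
    ≡⟨ pair-up (descent x y) (descent y z) (descent z x) (descent x z) (descent z y) (descent y x) ⟩
  (descent x y + descent y x) + (descent y z + descent z y) + (descent z x + descent x z)
    ≡⟨ cong₂ _+_ (cong₂ _+_ (descent-swap x≢y) (descent-swap y≢z)) (descent-swap (x≢z ∘ sym)) ⟩
  3 ∎
  where
  open ≡-Reasoning
  open +-*-Solver
  pair-up : ∀ p q r s t u → p + (q + (r + (s + (t + (u + 0))))) ≡ (p + u) + (q + t) + (r + s)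
  pair-up = solve 6 (λ p q r s t u →
    p :+ (q :+ (r :+ (s :+ (t :+ (u :+ con 0))))) := (p :+ u) :+ (q :+ t) :+ (r :+ s)) refl

abcacba-preimage : ∀ {f a b c} → Contains f (abcacba a b c) → a ≢ b → b ≢ c → a ≢ c →
  ∃[ x ] ∃[ y ] ∃[ z ] x ≢ y × y ≢ z × x ≢ z × abcacba x y z ⊆ f
abcacba-preimage (W , W⊆f , φ , inj , eq) a≢b b≢c a≢c
  with Pointwise.map⁻ φ id (≡⇒Pointwise-≡ eq)
... | _∷_ {x} φx≡a (_∷_ {y} φy≡b (_∷_ {z} φz≡c (φx′≡a ∷ φz′≡c ∷ φy′≡b ∷ φx″≡a ∷ [])))
  with refl ← inj (there (there (there (here refl)))) (here refl) (trans φx′≡a (sym φx≡a))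
     | refl ← inj (there (there (there (there (here refl))))) (there (there (here refl)))
                  (trans φz′≡c (sym φz≡c))
     | refl ← inj (there (there (there (there (there (here refl)))))) (there (here refl))
                  (trans φy′≡b (sym φy≡b))
     | refl ← inj (there (there (there (there (there (there (here refl))))))) (here refl)
                  (trans φx″≡a (sym φx≡a))
  = x , y , z , separate φx≡a φy≡b a≢b , separate φy≡b φz≡c b≢c , separate φx≡a φz≡c a≢c , W⊆f
  where
  separate : ∀ {p q a b} → φ p ≡ a → φ q ≡ b → a ≢ b → p ≢ q
  separate φp≡a φq≡b a≢b p≡q = a≢b (trans (sym φp≡a) (trans (cong φ p≡q) φq≡b))

abcacba⊆avav′a : ∀ a b c w₁ w₂ → abcacba a b c ⊆ avav′a a b (c ∷ w₁) w₂
abcacba⊆avav′a a b c w₁ w₂ =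
  refl ∷ refl ∷ refl ∷ ++⁺ˡ (w₁ ++ w₂) (refl ∷ refl ∷ ++⁺ (++⁺ˡ w₁ (refl ∷ minimum w₂)) (refl ∷ []))

identityFormation : ∀ r t → Formation r t (concat (replicate t (upTo r)))
identityFormation r t =
  upTo r , length-upTo r , upTo⁺ r , replicate t (upTo r) , length-replicate t , replicate⁺ t ↭-refl , refl

abcacba⊈identityFormation : ∀ r t → t < 4 → ∀ {x y z} → x ≢ y → y ≢ z → x ≢ z →
  ¬ abcacba x y z ⊆ concat (replicate t (upTo r))
abcacba⊈identityFormation r zero    _                 _   _   _   ()
abcacba⊈identityFormation r (suc t) (s≤s (s≤s t≤2)) x≢y y≢z x≢z abcacba⊆f =
  <⇒≱ (n<1+n 2) (subst (_≤ 2) (descents-abcacba x≢y y≢z x≢z)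
    (≤-trans (descents-⊆-replicate (applyUpTo⁺₁ id r (λ i<j _ → i<j)) t _ abcacba⊆f) t≤2))

fw>3 : ∀ {u a b c} → a ≢ b → b ≢ c → a ≢ c → abcacba a b c ⊆ u → ∀ t → t < 4 → ¬ FwBound u t
fw>3 a≢b b≢c a≢c abcacba⊆u t t<4 (r , contains)
  with x , y , z , x≢y , y≢z , x≢z , abcacba⊆f ←
         abcacba-preimage (contains-⊆ (contains _ (identityFormation r t)) abcacba⊆u) a≢b b≢c a≢c
  = abcacba⊈identityFormation r t t<4 x≢y y≢z x≢z abcacba⊆f

avav′a-take-drop : ∀ a b w i →
  avav′a a b (take i w) (drop i w) ≡ a ∷ (b ∷ w) ++ a ∷ (take i w ++ b ∷ drop i w) ++ [ a ]
avav′a-take-drop a b w i =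
  cong (λ v → a ∷ (b ∷ v) ++ a ∷ (take i w ++ b ∷ drop i w) ++ [ a ]) (take++drop≡id i w)

lemma4p1 : (a b : ℕ) (w : List ℕ) (i : ℕ) →
    a ∉ (b ∷ w) → Unique (b ∷ w) → 1 ≤ i → i ≤ length w →
    FwIs (a ∷ (b ∷ w) ++ a ∷ (take i w ++ b ∷ drop i w) ++ [ a ]) 4
lemma4p1 a b []      (suc i) _     _             _         ()
lemma4p1 a b (c ∷ w) (suc i) a∉bcw (b∉cw ∷ uniq) (s≤s z≤n) _ =
  subst (λ u → FwIs u 4) (avav′a-take-drop a b (c ∷ w) (suc i))
    ( fw≤4 a b (c ∷ take i w) (drop i w) unique
    , fw>3 (a∉bcw ∘ here) (All.head b∉cw) (a∉bcw ∘ there ∘ here)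
        (abcacba⊆avav′a a b c (take i w) (drop i w)))
  where
  unique : Unique (a ∷ b ∷ c ∷ take i w ++ drop i w)
  unique = subst (λ v → Unique (a ∷ b ∷ c ∷ v)) (sym (take++drop≡id i w))
    (¬Any⇒All¬ _ a∉bcw ∷ b∉cw ∷ uniq)
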